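{- Let $K$ be a finite group containing a normal subgroup $E\cong C_2^r$, and suppose that $\{A_u:u\in U_r\}$ is a signature set on $K$ with respect to $E$. Let $\{\chi_u:u\in U_r\}$ be the characters of $E$ and let $B_u=A_u\chi_u$ for each $u\in U_r$. Then the number of elements of $K$ at which the $\{\pm1\}$-valued function $B_u$ takes the value $-1$ equals $\frac12|K|$ if $u\neq0$, and equals $\frac12|K|+\epsilon\sqrt{2^{r-2}|K|}$ for some $\epsilon\in\{1,-1\}$ if $u=0$.
   Context: Functions on $K$ are identified with elements of $\mathbb{Z}K$ via $F\leftrightarrow\sum_g F(g)g$; for $A=\sum a_g g$, $A^{(-1)}=\sum a_g g^{ -1}$. Let $E=\langle x_1,\dots,x_r\rangle\cong C_2^r$, $U_r=\mathrm{GF}(2)^r$, and $\chi_u=\prod_{i=1}^r(1+(-1)^{u_i}x_i)\in\mathbb{Z}E$ for $u\in U_r$. A signature block on $K$ with respect to $\chi_u$ is an element $A_u\in\mathbb{Z}K$ that is $\{\pm1\}$-valued on some set of coset representatives for $E$ in $K$ and zero elsewhere, satisfying $A_u\chi_uA_u^{(-1)}=\frac{|K|}{2^r}\chi_u$ in $\mathbb{Z}K$. A signature set on $K$ with respect to $E$ is a multiset $\{A_u:u\in U_r\}$ with each $A_u$ a signature block with respect to $\chi_u$. (Each $B_u$ is then $\{\pm1\}$-valued on all of $K$.) -}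

module Defs where

open import Data.Nat as ℕ using (ℕ; zero; suc; _^_)
open import Data.Nat.Properties using (m^n≢0)
open import Data.Nat.DivMod using (_/_)
open import Data.Integer as ℤ using (ℤ; +_; -[1+_])
open import Data.Fin using (Fin; zero; suc; _≟_)
open import Data.Bool using (Bool; true; false; _xor_; if_then_else_)
open import Data.List using (List; length; filter)
open import Data.List using () renaming (allFin to allFinL)
open import Data.Product using (Σ; ∃; _×_; _,_)
open import Data.Sum using (_⊎_)
open import Relation.Nullary using (¬_; does)
open import Relation.Binary.PropositionalEquality using (_≡_)
open import Algebra.Structures using (IsGroup)

-- A finite group K of order n, with carrier Fin n (every finite group
-- is isomorphic to one of this form).

record FinGroup (n : ℕ) : Set where
  infixl 7 _·_
  field
    _·_     : Fin n → Fin n → Fin n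
    e       : Fin n
    _⁻¹     : Fin n → Fin n
    isGroup : IsGroup _≡_ _·_ e _⁻¹

-- U_r = GF(2)^r, as functions Fin r → Bool, with addition = xor.

U : ℕ → Set
U r = Fin r → Bool

_⊕_ : ∀ {r} → U r → U r → U r
(u ⊕ v) i = u i xor v i

basis : ∀ {r} → Fin r → U r
basis i j = does (i ≟ j)

IsZeroU : ∀ {r} → U r → Set
IsZeroU {r} u = ∀ (i : Fin r) → u i ≡ false

-- An embedding of C_2^r ≅ (U r, ⊕) as a normal subgroup E of K.
-- The generators of E are x_i = ι (basis i).

record NormalElemAbSub {n : ℕ} (K : FinGroup n) (r : ℕ) : Set where
  open FinGroup K
  field
    ι        : U r → Fin n
    ι-hom    : ∀ u v → ι (u ⊕ v) ≡ ι u · ι v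
    ι-inj    : ∀ u v → ι u ≡ ι v → ∀ i → u i ≡ v i
    ι-normal : ∀ (g : Fin n) (v : U r) → ∃ λ w → g · ι v · g ⁻¹ ≡ ι w

  x : Fin r → Fin n
  x i = ι (basis i)

  InE : Fin n → Set
  InE g = ∃ λ v → g ≡ ι v

Σℤ : ∀ m → (Fin m → ℤ) → ℤ
Σℤ zero    f = + 0
Σℤ (suc m) f = f zero ℤ.+ Σℤ m (λ i → f (suc i))

-- The integral group ring ℤK: functions K → ℤ, F ↔ Σ F(g) g.

module GroupRing {n : ℕ} (K : FinGroup n) where
  open FinGroup K

  ℤK : Set
  ℤK = Fin n → ℤ

  δ : Fin n → ℤK
  δ g h = if does (g ≟ h) then + 1 else + 0

  _+ᴷ_ : ℤK → ℤK → ℤK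
  (A +ᴷ B) g = A g ℤ.+ B g

  _•_ : ℤ → ℤK → ℤK
  (c • A) g = c ℤ.* A g

  infixl 7 _*ᴷ_
  infixl 6 _+ᴷ_
  _*ᴷ_ : ℤK → ℤK → ℤK
  (A *ᴷ B) g = Σℤ n (λ h → A h ℤ.* B (h ⁻¹ · g))

  oneᴷ : ℤK
  oneᴷ = δ e

  inv : ℤK → ℤK
  inv A g = A (g ⁻¹)

  Πᴷ : ∀ m → (Fin m → ℤK) → ℤK
  Πᴷ zero    f = oneᴷ
  Πᴷ (suc m) f = f zero *ᴷ Πᴷ m (λ i → f (suc i))

module Signature {n r : ℕ} (K : FinGroup n) (E : NormalElemAbSub K r) where
  open FinGroup K
  open NormalElemAbSub E
  open GroupRing K

  sgn : Bool → ℤ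
  sgn false = + 1
  sgn true  = -[1+ 0 ]

  χ : U r → ℤK
  χ u = Πᴷ r (λ i → oneᴷ +ᴷ (sgn (u i) • δ (x i)))

  IsCosetReps : (Fin n → Bool) → Set
  IsCosetReps T =
    (∀ g → ∃ λ t → T t ≡ true × InE (t ⁻¹ · g)) ×
    (∀ t t' → T t ≡ true → T t' ≡ true → InE (t ⁻¹ · t') → t ≡ t')

  index : ℕ
  index = _/_ n (2 ^ r) {{m^n≢0 2 r}}

  IsSignatureBlock : U r → ℤK → Set
  IsSignatureBlock u A =
    (Σ (Fin n → Bool) λ T →
       IsCosetReps T ×
       (∀ g → T g ≡ true → A g ≡ + 1 ⊎ A g ≡ -[1+ 0 ]) ×
       (∀ g → T g ≡ false → A g ≡ + 0)) ×
    (∀ g → (A *ᴷ χ u *ᴷ inv A) g ≡ ((+ index) • χ u) g)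

  IsSignatureSet : (U r → ℤK) → Set
  IsSignatureSet A = ∀ u → IsSignatureBlock u (A u)

  countMinusOne : ℤK → ℕ
  countMinusOne F = length (filter (λ g → F g ℤ.≟ -[1+ 0 ]) (allFinL n))

-- Let aug : ℤK → ℤ be the augmentation (sum of the values). It is multiplicative,
-- invariant under F ↦ F^(-1), and expanding the product defining χ_u gives
-- aug χ_u = ∏ᵢ (1 + (-1)^{u_i}), i.e. 0 for u ≠ 0 and 2^r for u = 0. Since A_u lives on a transversal T
-- of E and χ_u on E, with values ±1 there, B_u(t y) = A_u(t) χ_u(y) for y ∈ E, so B_u is ±1-valued and
-- aug B_u = |K| - 2N. Now aug B_u = aug(A_u) aug(χ_u): this is 0 for u ≠ 0, while for u = 0 applying aug
-- to A χ A^(-1) = (|K|/2^r) χ gives aug(A_u)² = |K|/2^r, and s = |aug A_u| 2^r does the job.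
-- Evaluating the same identity at the identity shows |T| = |K|/2^r; counting K = T E with the function
-- 1_T χ_0 then shows |E| = 2^r and |K| = |T| 2^r.

module Submission where

open import Defs
import Data.Nat as ℕ
open import Data.Nat using (ℕ; zero; suc; _^_; NonZero; z≤n; s≤s)
import Data.Nat.Properties as ℕP
open import Data.Nat.DivMod using (_/_; /-monoˡ-≤; m*n/n≡m)
import Data.Nat.Solver as ℕSolver
import Data.Integer as ℤ
open import Data.Integer using (ℤ; +_; -[1+_]; -_; ∣_∣; +≤+)
import Data.Integer.Properties as ℤP
open import Data.Integer.Solver using (module +-*-Solver)
open import Data.Fin using (Fin; zero; suc; toℕ)
open import Data.Fin.Properties using (suc-injective; pigeonhole) renaming (_≟_ to _≟F_)
open import Data.Fin.Permutation using (permutation)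
open import Data.Bool using (Bool; true; false; _xor_; if_then_else_)
open import Data.Bool.Properties using (xor-identityʳ; xor-same)
open import Data.Vec using (Vec; []; _∷_; lookup; replicate; tabulate)
open import Data.Vec.Properties using (tabulate∘lookup; tabulate-cong; ∷-injective; lookup∘tabulate)
import Data.List as List
open List using (length; filter)
open import Data.Product using (Σ; ∃; _×_; _,_; proj₁; proj₂)
open import Data.Sum using (_⊎_; inj₁; inj₂)
open import Data.Empty using (⊥-elim)
open import Relation.Nullary using (¬_; yes; no)
open import Relation.Nullary.Decidable using (decidable-stable)
open import Relation.Binary.PropositionalEquality
open import Function using (id; _∘_; case_of_)
open import Algebra.Bundles using (Group)
open import Algebra.Structures using (IsGroup)
import Algebra.Properties.Group as GroupProperties
import Algebra.Properties.Semiring.Sum as SemiringSum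

[m/n*n]+[m/n*n]≰m : ∀ m n .{{_ : NonZero n}} → 1 ℕ.≤ m / n → ¬ (m / n ℕ.* n ℕ.+ m / n ℕ.* n ℕ.≤ m)
[m/n*n]+[m/n*n]≰m m n 1≤q qn+qn≤m = ℕP.<-irrefl refl (ℕP.<-≤-trans (ℕP.m<m+n q 1≤q) q+q≤q)
  where
  open import Data.Nat using (_+_; _*_)
  q = m / n
  q+q≤q : q + q ℕ.≤ q
  q+q≤q = begin
    q + q              ≡⟨ m*n/n≡m (q + q) n ⟨
    (q + q) * n / n    ≤⟨ /-monoˡ-≤ n (subst (ℕ._≤ m) (sym (ℕP.*-distribʳ-+ n q q)) qn+qn≤m) ⟩
    m / n              ∎
    where open ℕP.≤-Reasoning

module FiniteSums where
  open import Data.Integer using (_+_; _*_; _≤_)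
  open SemiringSum ℤP.+-*-semiring using (sum; ∑-distrib-+; ∑-comm; ∑-permute; *-distribˡ-sum)

  Σℤ≡sum : ∀ m f → Σℤ m f ≡ sum f
  Σℤ≡sum zero    f = refl
  Σℤ≡sum (suc m) f = cong (_+_ (f zero)) (Σℤ≡sum m (f ∘ suc))

  Σℤ-cong : ∀ m {f g : Fin m → ℤ} → (∀ i → f i ≡ g i) → Σℤ m f ≡ Σℤ m g
  Σℤ-cong zero    f≗g = refl
  Σℤ-cong (suc m) f≗g = cong₂ _+_ (f≗g zero) (Σℤ-cong m (f≗g ∘ suc))

  Σℤ-distrib-+ : ∀ m (f g : Fin m → ℤ) → Σℤ m (λ i → f i + g i) ≡ Σℤ m f + Σℤ m g
  Σℤ-distrib-+ m f g = begin
    Σℤ m (λ i → f i + g i) ≡⟨ Σℤ≡sum m _ ⟩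
    sum (λ i → f i + g i)  ≡⟨ ∑-distrib-+ f g ⟩
    sum f + sum g          ≡⟨ cong₂ _+_ (Σℤ≡sum m f) (Σℤ≡sum m g) ⟨
    Σℤ m f + Σℤ m g        ∎
    where open ≡-Reasoning

  *-distribˡ-Σℤ : ∀ m c (f : Fin m → ℤ) → c * Σℤ m f ≡ Σℤ m (λ i → c * f i)
  *-distribˡ-Σℤ m c f = begin
    c * Σℤ m f             ≡⟨ cong (c *_) (Σℤ≡sum m f) ⟩
    c * sum f              ≡⟨ *-distribˡ-sum c f ⟩
    sum (λ i → c * f i)    ≡⟨ Σℤ≡sum m _ ⟨
    Σℤ m (λ i → c * f i)   ∎
    where open ≡-Reasoning

  *-distribʳ-Σℤ : ∀ m c (f : Fin m → ℤ) → Σℤ m f * c ≡ Σℤ m (λ i → f i * c)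
  *-distribʳ-Σℤ m c f = begin
    Σℤ m f * c             ≡⟨ ℤP.*-comm (Σℤ m f) c ⟩
    c * Σℤ m f             ≡⟨ *-distribˡ-Σℤ m c f ⟩
    Σℤ m (λ i → c * f i)   ≡⟨ Σℤ-cong m (λ i → ℤP.*-comm c (f i)) ⟩
    Σℤ m (λ i → f i * c)   ∎
    where open ≡-Reasoning

  Σℤ-comm : ∀ m k (f : Fin m → Fin k → ℤ) →
            Σℤ m (λ i → Σℤ k (f i)) ≡ Σℤ k (λ j → Σℤ m (λ i → f i j))
  Σℤ-comm m k f = begin
    Σℤ m (λ i → Σℤ k (f i))           ≡⟨ Σℤ-cong m (λ i → Σℤ≡sum k (f i)) ⟩
    Σℤ m (λ i → sum (f i))            ≡⟨ Σℤ≡sum m _ ⟩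
    sum (λ i → sum (f i))             ≡⟨ ∑-comm f ⟩
    sum (λ j → sum (λ i → f i j))     ≡⟨ Σℤ≡sum k _ ⟨
    Σℤ k (λ j → sum (λ i → f i j))    ≡⟨ Σℤ-cong k (λ j → Σℤ≡sum m _) ⟨
    Σℤ k (λ j → Σℤ m (λ i → f i j))   ∎
    where open ≡-Reasoning

  Σℤ-reindex : ∀ m (f : Fin m → ℤ) (π π⁻ : Fin m → Fin m) →
               (∀ i → π (π⁻ i) ≡ i) → (∀ i → π⁻ (π i) ≡ i) →
               Σℤ m (f ∘ π) ≡ Σℤ m f
  Σℤ-reindex m f π π⁻ ππ⁻ π⁻π = begin
    Σℤ m (f ∘ π)   ≡⟨ Σℤ≡sum m _ ⟩
    sum (f ∘ π)    ≡⟨ ∑-permute f (permutation π π⁻ ππ⁻ π⁻π) ⟨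
    sum f          ≡⟨ Σℤ≡sum m f ⟨
    Σℤ m f         ∎
    where open ≡-Reasoning

  Σℤ-zero : ∀ m {f : Fin m → ℤ} → (∀ i → f i ≡ + 0) → Σℤ m f ≡ + 0
  Σℤ-zero zero    f≡0 = refl
  Σℤ-zero (suc m) f≡0 = cong₂ _+_ (f≡0 zero) (Σℤ-zero m (f≡0 ∘ suc))

  Σℤ-single : ∀ m (f : Fin m → ℤ) i → (∀ j → j ≢ i → f j ≡ + 0) → Σℤ m f ≡ f i
  Σℤ-single (suc m) f zero    others = begin
    f zero + Σℤ m (f ∘ suc)  ≡⟨ cong (_+_ (f zero)) (Σℤ-zero m (λ j → others (suc j) λ ())) ⟩
    f zero + + 0             ≡⟨ ℤP.+-identityʳ (f zero) ⟩
    f zero                   ∎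
    where open ≡-Reasoning
  Σℤ-single (suc m) f (suc i) others = begin
    f zero + Σℤ m (f ∘ suc)  ≡⟨ cong (_+ Σℤ m (f ∘ suc)) (others zero λ ()) ⟩
    + 0 + Σℤ m (f ∘ suc)     ≡⟨ ℤP.+-identityˡ _ ⟩
    Σℤ m (f ∘ suc)           ≡⟨ Σℤ-single m (f ∘ suc) i (λ j j≢i → others (suc j) (j≢i ∘ suc-injective)) ⟩
    f (suc i)                ∎
    where open ≡-Reasoning

  Σℤ-mono-≤ : ∀ m {f g : Fin m → ℤ} → (∀ i → f i ≤ g i) → Σℤ m f ≤ Σℤ m g
  Σℤ-mono-≤ zero    f≤g = ℤP.≤-refl
  Σℤ-mono-≤ (suc m) f≤g = ℤP.+-mono-≤ (f≤g zero) (Σℤ-mono-≤ m (f≤g ∘ suc))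

  Σℤ-ones : ∀ m → Σℤ m (λ _ → + 1) ≡ + m
  Σℤ-ones zero    = refl
  Σℤ-ones (suc m) = cong (_+_ (+ 1)) (Σℤ-ones m)

  Σℤ-nonneg : ∀ m {f : Fin m → ℤ} → (∀ j → + 0 ≤ f j) → + 0 ≤ Σℤ m f
  Σℤ-nonneg zero    f≥0 = ℤP.≤-refl
  Σℤ-nonneg (suc m) f≥0 = ℤP.+-mono-≤ (f≥0 zero) (Σℤ-nonneg m (f≥0 ∘ suc))

  Σℤ-term-≤ : ∀ m (f : Fin m → ℤ) → (∀ j → + 0 ≤ f j) → ∀ i → f i ≤ Σℤ m f
  Σℤ-term-≤ (suc m) f f≥0 zero = begin
    f zero                   ≡⟨ ℤP.+-identityʳ (f zero) ⟨
    f zero + + 0             ≤⟨ ℤP.+-monoʳ-≤ (f zero) (Σℤ-nonneg m (f≥0 ∘ suc)) ⟩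
    f zero + Σℤ m (f ∘ suc)  ∎
    where open ℤP.≤-Reasoning
  Σℤ-term-≤ (suc m) f f≥0 (suc i) = begin
    f (suc i)                ≤⟨ Σℤ-term-≤ m (f ∘ suc) (f≥0 ∘ suc) i ⟩
    Σℤ m (f ∘ suc)           ≡⟨ ℤP.+-identityˡ _ ⟨
    + 0 + Σℤ m (f ∘ suc)     ≤⟨ ℤP.+-monoˡ-≤ (Σℤ m (f ∘ suc)) (f≥0 zero) ⟩
    f zero + Σℤ m (f ∘ suc)  ∎
    where open ℤP.≤-Reasoning

  IsSign : ℤ → Set
  IsSign x = x ≡ + 1 ⊎ x ≡ -[1+ 0 ]

  IsSign-* : ∀ {x y} → IsSign x → IsSign y → IsSign (x * y)
  IsSign-* (inj₁ refl) (inj₁ refl) = inj₁ refl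
  IsSign-* (inj₁ refl) (inj₂ refl) = inj₂ refl
  IsSign-* (inj₂ refl) (inj₁ refl) = inj₂ refl
  IsSign-* (inj₂ refl) (inj₂ refl) = inj₁ refl

  IsSign-square : ∀ {x} → IsSign x → x * x ≡ + 1
  IsSign-square (inj₁ refl) = refl
  IsSign-square (inj₂ refl) = refl

  module _ {a} {X : Set a} (F : X → ℤ) where

    countMinusOneOn : ∀ m → (Fin m → X) → ℕ
    countMinusOneOn m h = length (filter (λ x → F x ℤ.≟ -[1+ 0 ]) (List.tabulate h))

    Σℤ±1+2*count : ∀ m (h : Fin m → X) → (∀ i → IsSign (F (h i))) →
                   Σℤ m (F ∘ h) + + 2 * + countMinusOneOn m h ≡ + m
    Σℤ±1+2*count zero    h ±1 = refl
    Σℤ±1+2*count (suc m) h ±1 with F (h zero) ℤ.≟ -[1+ 0 ] | ±1 zero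
    ... | yes F₀≡-1 | _ rewrite F₀≡-1 =
      trans (shift (Σℤ m (F ∘ h ∘ suc)) (+ countMinusOneOn m (h ∘ suc)))
            (cong (_+_ (+ 1)) (Σℤ±1+2*count m (h ∘ suc) (±1 ∘ suc)))
      where
      open +-*-Solver
      shift : ∀ S c → -[1+ 0 ] + S + + 2 * (+ 1 + c) ≡ + 1 + (S + + 2 * c)
      shift = solve 2 (λ S c → con -[1+ 0 ] :+ S :+ con (+ 2) :* (con (+ 1) :+ c)
                            := con (+ 1) :+ (S :+ con (+ 2) :* c)) refl
    ... | no F₀≢-1 | inj₂ F₀≡-1 = ⊥-elim (F₀≢-1 F₀≡-1)
    ... | no _     | inj₁ F₀≡1 rewrite F₀≡1 =
      trans (ℤP.+-assoc (+ 1) (Σℤ m (F ∘ h ∘ suc)) (+ 2 * + countMinusOneOn m (h ∘ suc)))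
            (cong (_+_ (+ 1)) (Σℤ±1+2*count m (h ∘ suc) (±1 ∘ suc)))

open FiniteSums

module BooleanCube where
  open import Data.Integer using (_+_; _*_)

  Σcube : ∀ m → (Vec Bool m → ℤ) → ℤ
  Σcube zero    f = f []
  Σcube (suc m) f = Σcube m (f ∘ (false ∷_)) + Σcube m (f ∘ (true ∷_))

  Σcube-cong : ∀ m {f g : Vec Bool m → ℤ} → (∀ w → f w ≡ g w) → Σcube m f ≡ Σcube m g
  Σcube-cong zero    f≗g = f≗g []
  Σcube-cong (suc m) f≗g = cong₂ _+_ (Σcube-cong m (f≗g ∘ (false ∷_))) (Σcube-cong m (f≗g ∘ (true ∷_)))

  *-distribˡ-Σcube : ∀ m c (f : Vec Bool m → ℤ) → c * Σcube m f ≡ Σcube m (λ w → c * f w)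
  *-distribˡ-Σcube zero    c f = refl
  *-distribˡ-Σcube (suc m) c f =
    trans (ℤP.*-distribˡ-+ c _ _) (cong₂ _+_ (*-distribˡ-Σcube m c _) (*-distribˡ-Σcube m c _))

  Σcube-zero : ∀ m {f : Vec Bool m → ℤ} → (∀ w → f w ≡ + 0) → Σcube m f ≡ + 0
  Σcube-zero zero    f≡0 = f≡0 []
  Σcube-zero (suc m) f≡0 = cong₂ _+_ (Σcube-zero m (f≡0 ∘ (false ∷_))) (Σcube-zero m (f≡0 ∘ (true ∷_)))

  Σcube-single : ∀ m (f : Vec Bool m → ℤ) w → (∀ v → v ≢ w → f v ≡ + 0) → Σcube m f ≡ f w
  Σcube-single zero    f []          others = refl
  Σcube-single (suc m) f (false ∷ w) others =
    trans (cong₂ _+_ (Σcube-single m _ w (λ v v≢w → others (false ∷ v) (v≢w ∘ proj₂ ∘ ∷-injective)))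
                     (Σcube-zero m (λ v → others (true ∷ v) (λ ()))))
          (ℤP.+-identityʳ _)
  Σcube-single (suc m) f (true ∷ w)  others =
    trans (cong₂ _+_ (Σcube-zero m (λ v → others (false ∷ v) (λ ())))
                     (Σcube-single m _ w (λ v v≢w → others (true ∷ v) (v≢w ∘ proj₂ ∘ ∷-injective))))
          (ℤP.+-identityˡ _)

  Σcube-nonzero : ∀ m (f : Vec Bool m → ℤ) → Σcube m f ≢ + 0 → ∃ λ w → f w ≢ + 0
  Σcube-nonzero zero    f Σ≢0 = [] , Σ≢0
  Σcube-nonzero (suc m) f Σ≢0 with Σcube m (f ∘ (false ∷_)) ℤ.≟ + 0 | Σcube m (f ∘ (true ∷_)) ℤ.≟ + 0
  ... | no Σ₀≢0 | _       = let w , fw≢0 = Σcube-nonzero m _ Σ₀≢0 in false ∷ w , fw≢0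
  ... | yes _   | no Σ₁≢0 = let w , fw≢0 = Σcube-nonzero m _ Σ₁≢0 in true ∷ w , fw≢0
  ... | yes Σ₀≡0 | yes Σ₁≡0 = ⊥-elim (Σ≢0 (cong₂ _+_ Σ₀≡0 Σ₁≡0))

  Σℤ-Σcube-comm : ∀ m k (f : Vec Bool m → Fin k → ℤ) →
                  Σℤ k (λ j → Σcube m (λ w → f w j)) ≡ Σcube m (λ w → Σℤ k (f w))
  Σℤ-Σcube-comm zero    k f = refl
  Σℤ-Σcube-comm (suc m) k f =
    trans (Σℤ-distrib-+ k _ _) (cong₂ _+_ (Σℤ-Σcube-comm m k _) (Σℤ-Σcube-comm m k _))

  coeff : ∀ {m} → (Fin m → ℤ) → Vec Bool m → ℤ
  coeff s []          = + 1
  coeff s (false ∷ w) = coeff (s ∘ suc) w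
  coeff s (true ∷ w)  = s zero * coeff (s ∘ suc) w

  coeff-sign : ∀ {m} (s : Fin m → ℤ) → (∀ i → IsSign (s i)) → ∀ w → IsSign (coeff s w)
  coeff-sign s ±s []          = inj₁ refl
  coeff-sign s ±s (false ∷ w) = coeff-sign (s ∘ suc) (±s ∘ suc) w
  coeff-sign s ±s (true ∷ w)  = IsSign-* (±s zero) (coeff-sign (s ∘ suc) (±s ∘ suc) w)

  coeff-ones : ∀ {m} (s : Fin m → ℤ) → (∀ i → s i ≡ + 1) → ∀ w → coeff s w ≡ + 1
  coeff-ones s s≡1 []          = refl
  coeff-ones s s≡1 (false ∷ w) = coeff-ones (s ∘ suc) (s≡1 ∘ suc) w
  coeff-ones s s≡1 (true ∷ w)  = cong₂ _*_ (s≡1 zero) (coeff-ones (s ∘ suc) (s≡1 ∘ suc) w)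

  coeff-empty : ∀ {m} (s : Fin m → ℤ) → coeff s (replicate m false) ≡ + 1
  coeff-empty {zero}  s = refl
  coeff-empty {suc m} s = coeff-empty (s ∘ suc)

  Σcube-coeff-suc : ∀ m (s : Fin (suc m) → ℤ) →
                    Σcube (suc m) (coeff s) ≡ (+ 1 + s zero) * Σcube m (coeff (s ∘ suc))
  Σcube-coeff-suc m s = begin
    Σcube m (coeff (s ∘ suc)) + Σcube m (λ w → s zero * coeff (s ∘ suc) w)
      ≡⟨ cong₂ _+_ (ℤP.*-identityˡ (Σcube m (coeff (s ∘ suc)))) (*-distribˡ-Σcube m (s zero) (coeff (s ∘ suc))) ⟨
    + 1 * Σcube m (coeff (s ∘ suc)) + s zero * Σcube m (coeff (s ∘ suc))
      ≡⟨ ℤP.*-distribʳ-+ _ (+ 1) (s zero) ⟨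
    (+ 1 + s zero) * Σcube m (coeff (s ∘ suc)) ∎
    where open ≡-Reasoning

  Σcube-coeff-vanishes : ∀ m (s : Fin m → ℤ) i → s i ≡ -[1+ 0 ] → Σcube m (coeff s) ≡ + 0
  Σcube-coeff-vanishes (suc m) s zero    s₀≡-1 =
    trans (Σcube-coeff-suc m s) (cong (λ x → (+ 1 + x) * Σcube m (coeff (s ∘ suc))) s₀≡-1)
  Σcube-coeff-vanishes (suc m) s (suc i) sᵢ≡-1 =
    trans (Σcube-coeff-suc m s)
          (trans (cong ((+ 1 + s zero) *_) (Σcube-coeff-vanishes m (s ∘ suc) i sᵢ≡-1)) (ℤP.*-zeroʳ (+ 1 + s zero)))

  Σcube-coeff-ones : ∀ m (s : Fin m → ℤ) → (∀ i → s i ≡ + 1) → Σcube m (coeff s) ≡ + (2 ^ m)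
  Σcube-coeff-ones zero    s s≡1 = refl
  Σcube-coeff-ones (suc m) s s≡1 = begin
    Σcube (suc m) (coeff s)
      ≡⟨ Σcube-coeff-suc m s ⟩
    (+ 1 + s zero) * Σcube m (coeff (s ∘ suc))
      ≡⟨ cong₂ (λ x y → (+ 1 + x) * y) (s≡1 zero) (Σcube-coeff-ones m (s ∘ suc) (s≡1 ∘ suc)) ⟩
    + 2 * + (2 ^ m)
      ≡⟨ ℤP.pos-* 2 (2 ^ m) ⟨
    + (2 ^ suc m) ∎
    where open ≡-Reasoning

  zeroU : ∀ {r} → U r
  zeroU _ = false

  lincomb : ∀ {m r} → (Fin m → U r) → Vec Bool m → U r
  lincomb b []          = zeroU
  lincomb b (false ∷ w) = lincomb (b ∘ suc) w
  lincomb b (true ∷ w)  = b zero ⊕ lincomb (b ∘ suc) w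

  lincomb-empty : ∀ {m r} (b : Fin m → U r) → lincomb b (replicate m false) ≡ zeroU
  lincomb-empty {zero}  b = refl
  lincomb-empty {suc m} b = lincomb-empty (b ∘ suc)

  lincomb-zero-column : ∀ {m r} (b : Fin m → U r) j → (∀ i → b i j ≡ false) → ∀ w → lincomb b w j ≡ false
  lincomb-zero-column b j col≡0 []          = refl
  lincomb-zero-column b j col≡0 (false ∷ w) = lincomb-zero-column (b ∘ suc) j (col≡0 ∘ suc) w
  lincomb-zero-column b j col≡0 (true ∷ w)
    rewrite col≡0 zero = lincomb-zero-column (b ∘ suc) j (col≡0 ∘ suc) w

  lincomb-unit-column : ∀ {m r} (b : Fin m → U r) j i₀ → b i₀ j ≡ true → (∀ i → i ≢ i₀ → b i j ≡ false) →
                        ∀ w → lincomb b w j ≡ lookup w i₀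
  lincomb-unit-column b j zero     b₀≡1 others (false ∷ w) =
    lincomb-zero-column (b ∘ suc) j (λ i → others (suc i) λ ()) w
  lincomb-unit-column b j zero     b₀≡1 others (true ∷ w)
    rewrite b₀≡1 | lincomb-zero-column (b ∘ suc) j (λ i → others (suc i) λ ()) w = refl
  lincomb-unit-column b j (suc i₀) bᵢ≡1 others (false ∷ w) =
    lincomb-unit-column (b ∘ suc) j i₀ bᵢ≡1 (λ i i≢i₀ → others (suc i) (i≢i₀ ∘ suc-injective)) w
  lincomb-unit-column b j (suc i₀) bᵢ≡1 others (true ∷ w)
    rewrite others zero (λ ()) =
    lincomb-unit-column (b ∘ suc) j i₀ bᵢ≡1 (λ i i≢i₀ → others (suc i) (i≢i₀ ∘ suc-injective)) w

  lincomb-basis : ∀ {r} (w : Vec Bool r) j → lincomb basis w j ≡ lookup w j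
  lincomb-basis w j = lincomb-unit-column basis j j basis-diagonal basis-off-diagonal w
    where
    basis-diagonal : basis j j ≡ true
    basis-diagonal with j ≟F j
    ... | yes _   = refl
    ... | no j≢j = ⊥-elim (j≢j refl)
    basis-off-diagonal : ∀ i → i ≢ j → basis i j ≡ false
    basis-off-diagonal i i≢j with i ≟F j
    ... | yes i≡j = ⊥-elim (i≢j i≡j)
    ... | no _    = refl

  lookup-injective : ∀ {a} {A : Set a} {m} (v w : Vec A m) → (∀ i → lookup v i ≡ lookup w i) → v ≡ w
  lookup-injective v w v≗w = trans (sym (tabulate∘lookup v)) (trans (tabulate-cong v≗w) (tabulate∘lookup w))

open BooleanCube

module GroupRingProperties {n : ℕ} (K : FinGroup n) where
  open import Data.Integer using (_+_; _*_)
  open FinGroup K public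
  open GroupRing K public
  open IsGroup isGroup public using (assoc; identityˡ; identityʳ; inverseˡ)

  group : Group _ _
  group = record { isGroup = isGroup }

  open GroupProperties group public
    using (\\-leftDividesˡ; \\-leftDividesʳ; //-rightDividesˡ; //-rightDividesʳ;
           ⁻¹-involutive; ⁻¹-anti-homo-∙; ε⁻¹≈ε; ∙-cancelˡ; ∙-cancelʳ; inverseʳ-unique)

  δ-diagonal : ∀ y → δ y y ≡ + 1
  δ-diagonal y with y ≟F y
  ... | yes _   = refl
  ... | no y≢y = ⊥-elim (y≢y refl)

  δ-off-diagonal : ∀ y h → h ≢ y → δ y h ≡ + 0
  δ-off-diagonal y h h≢y with y ≟F h
  ... | yes y≡h = ⊥-elim (h≢y (sym y≡h))
  ... | no _    = refl

  δ-translate : ∀ y x k → δ (y · x) k ≡ δ x (y ⁻¹ · k)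
  δ-translate y x k with (y · x) ≟F k | x ≟F (y ⁻¹ · k)
  ... | yes _    | yes _    = refl
  ... | no _     | no _     = refl
  ... | yes yx≡k | no x≢    = ⊥-elim (x≢ (trans (sym (\\-leftDividesʳ y x)) (cong (y ⁻¹ ·_) yx≡k)))
  ... | no yx≢k  | yes x≡   = ⊥-elim (yx≢k (trans (cong (y ·_) x≡) (\\-leftDividesˡ y k)))

  Σℤ-δ : ∀ y (G : Fin n → ℤ) → Σℤ n (λ h → δ y h * G h) ≡ G y
  Σℤ-δ y G = begin
    Σℤ n (λ h → δ y h * G h)  ≡⟨ Σℤ-single n _ y (λ h h≢y → cong (_* G h) (δ-off-diagonal y h h≢y)) ⟩
    δ y y * G y               ≡⟨ cong (_* G y) (δ-diagonal y) ⟩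
    + 1 * G y                 ≡⟨ ℤP.*-identityˡ (G y) ⟩
    G y                       ∎
    where open ≡-Reasoning

  [1+sδ]*ᴷ : ∀ s y (P : ℤK) k → ((oneᴷ +ᴷ (s • δ y)) *ᴷ P) k ≡ P k + s * P (y ⁻¹ · k)
  [1+sδ]*ᴷ s y P k = begin
    Σℤ n (λ h → (δ e h + s * δ y h) * P (h ⁻¹ · k))
      ≡⟨ Σℤ-cong n (λ h → trans (ℤP.*-distribʳ-+ (P (h ⁻¹ · k)) (δ e h) (s * δ y h))
                                (cong (_+_ (δ e h * P (h ⁻¹ · k))) (ℤP.*-assoc s (δ y h) (P (h ⁻¹ · k))))) ⟩
    Σℤ n (λ h → δ e h * P (h ⁻¹ · k) + s * (δ y h * P (h ⁻¹ · k)))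
      ≡⟨ Σℤ-distrib-+ n _ _ ⟩
    Σℤ n (λ h → δ e h * P (h ⁻¹ · k)) + Σℤ n (λ h → s * (δ y h * P (h ⁻¹ · k)))
      ≡⟨ cong (_+_ (Σℤ n (λ h → δ e h * P (h ⁻¹ · k)))) (*-distribˡ-Σℤ n s _) ⟨
    Σℤ n (λ h → δ e h * P (h ⁻¹ · k)) + s * Σℤ n (λ h → δ y h * P (h ⁻¹ · k))
      ≡⟨ cong₂ (λ a b → a + s * b) (Σℤ-δ e (λ h → P (h ⁻¹ · k))) (Σℤ-δ y (λ h → P (h ⁻¹ · k))) ⟩
    P (e ⁻¹ · k) + s * P (y ⁻¹ · k)
      ≡⟨ cong (λ x → P (x · k) + s * P (y ⁻¹ · k)) ε⁻¹≈ε ⟩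
    P (e · k) + s * P (y ⁻¹ · k)
      ≡⟨ cong (λ x → P x + s * P (y ⁻¹ · k)) (identityˡ k) ⟩
    P k + s * P (y ⁻¹ · k) ∎
    where open ≡-Reasoning

  aug : ℤK → ℤ
  aug = Σℤ n

  aug-δ : ∀ y → aug (δ y) ≡ + 1
  aug-δ y = trans (Σℤ-cong n (λ h → sym (ℤP.*-identityʳ (δ y h)))) (Σℤ-δ y (λ _ → + 1))

  aug-translateˡ : ∀ (F : ℤK) x → Σℤ n (λ g → F (x · g)) ≡ aug F
  aug-translateˡ F x = Σℤ-reindex n F (x ·_) (x ⁻¹ ·_) (\\-leftDividesˡ x) (\\-leftDividesʳ x)

  aug-translateʳ : ∀ (F : ℤK) x → Σℤ n (λ g → F (g · x)) ≡ aug F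
  aug-translateʳ F x = Σℤ-reindex n F (_· x) (_· x ⁻¹) (//-rightDividesˡ x) (//-rightDividesʳ x)

  aug-homo-*ᴷ : ∀ F G → aug (F *ᴷ G) ≡ aug F * aug G
  aug-homo-*ᴷ F G = begin
    Σℤ n (λ g → Σℤ n (λ h → F h * G (h ⁻¹ · g)))  ≡⟨ Σℤ-comm n n _ ⟩
    Σℤ n (λ h → Σℤ n (λ g → F h * G (h ⁻¹ · g)))  ≡⟨ Σℤ-cong n (λ h → *-distribˡ-Σℤ n (F h) _) ⟨
    Σℤ n (λ h → F h * Σℤ n (λ g → G (h ⁻¹ · g)))  ≡⟨ Σℤ-cong n (λ h → cong (F h *_) (aug-translateˡ G (h ⁻¹))) ⟩
    Σℤ n (λ h → F h * aug G)                       ≡⟨ *-distribʳ-Σℤ n (aug G) F ⟨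
    aug F * aug G                                  ∎
    where open ≡-Reasoning

  aug-inv : ∀ F → aug (inv F) ≡ aug F
  aug-inv F = Σℤ-reindex n F _⁻¹ _⁻¹ ⁻¹-involutive ⁻¹-involutive

  infixr 8 _^ᴷ_
  _^ᴷ_ : Fin n → ℕ → Fin n
  x ^ᴷ zero  = e
  x ^ᴷ suc k = x · x ^ᴷ k

  ^ᴷ-homo-+ : ∀ x a b → x ^ᴷ (a ℕ.+ b) ≡ x ^ᴷ a · x ^ᴷ b
  ^ᴷ-homo-+ x zero    b = sym (identityˡ (x ^ᴷ b))
  ^ᴷ-homo-+ x (suc a) b = trans (cong (x ·_) (^ᴷ-homo-+ x a b)) (sym (assoc x (x ^ᴷ a) (x ^ᴷ b)))

  finite-order : ∀ x → ∃ λ k → x ^ᴷ suc k ≡ e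
  finite-order x with pigeonhole (ℕP.n<1+n n) (λ (i : Fin (suc n)) → x ^ᴷ toℕ i)
  ... | i , j , i<j , xⁱ≡xʲ with ℕP.m≤n⇒∃[o]m+o≡n i<j
  ...   | k , 1+i+k≡j = k , ∙-cancelˡ (x ^ᴷ toℕ i) (x ^ᴷ suc k) e (begin
    x ^ᴷ toℕ i · x ^ᴷ suc k  ≡⟨ ^ᴷ-homo-+ x (toℕ i) (suc k) ⟨
    x ^ᴷ (toℕ i ℕ.+ suc k)   ≡⟨ cong (x ^ᴷ_) (trans (ℕP.+-suc (toℕ i) k) 1+i+k≡j) ⟩
    x ^ᴷ toℕ j               ≡⟨ xⁱ≡xʲ ⟨
    x ^ᴷ toℕ i               ≡⟨ identityʳ (x ^ᴷ toℕ i) ⟨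
    x ^ᴷ toℕ i · e           ∎)
    where open ≡-Reasoning

module Characters {n r : ℕ} (K : FinGroup n) (E : NormalElemAbSub K r) where
  open import Data.Integer using (_+_; _*_; _≤_)
  open GroupRingProperties K public
  open NormalElemAbSub E public
  open Signature K E public

  ι-zeroU : ι zeroU ≡ e
  ι-zeroU = ∙-cancelˡ (ι zeroU) (ι zeroU) e (trans (sym (ι-hom zeroU zeroU)) (sym (identityʳ (ι zeroU))))

  multiple : U r → ℕ → U r
  multiple v zero    = zeroU
  multiple v (suc k) = v ⊕ multiple v k

  ι-multiple : ∀ v k → ι (multiple v k) ≡ ι v ^ᴷ k
  ι-multiple v zero    = ι-zeroU
  ι-multiple v (suc k) = trans (ι-hom v (multiple v k)) (cong (ι v ·_) (ι-multiple v k))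

  InE-· : ∀ x y → InE x → InE y → InE (x · y)
  InE-· _ _ (v , refl) (w , refl) = v ⊕ w , sym (ι-hom v w)

  InE-⁻¹ : ∀ x → InE x → InE (x ⁻¹)
  InE-⁻¹ _ (v , refl) with finite-order (ι v)
  ... | k , xᵏ⁺¹≡e = multiple v k , trans (sym (inverseʳ-unique (ι v) (ι v ^ᴷ k) xᵏ⁺¹≡e)) (sym (ι-multiple v k))

  Πᴷ-expansion : ∀ m (b : Fin m → U r) (s : Fin m → ℤ) k →
                 Πᴷ m (λ i → oneᴷ +ᴷ (s i • δ (ι (b i)))) k ≡
                 Σcube m (λ w → coeff s w * δ (ι (lincomb b w)) k)
  Πᴷ-expansion zero    b s k = trans (cong (λ x → δ x k) (sym ι-zeroU)) (sym (ℤP.*-identityˡ _))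
  Πᴷ-expansion (suc m) b s k = begin
    ((oneᴷ +ᴷ (s zero • δ y)) *ᴷ P) k
      ≡⟨ [1+sδ]*ᴷ (s zero) y P k ⟩
    P k + s zero * P (y ⁻¹ · k)
      ≡⟨ cong₂ (λ a b → a + s zero * b) (Πᴷ-expansion m (b ∘ suc) (s ∘ suc) k)
                                         (Πᴷ-expansion m (b ∘ suc) (s ∘ suc) (y ⁻¹ · k)) ⟩
    Σcube m (λ w → coeff (s ∘ suc) w * δ (ι (lincomb (b ∘ suc) w)) k) +
    s zero * Σcube m (λ w → coeff (s ∘ suc) w * δ (ι (lincomb (b ∘ suc) w)) (y ⁻¹ · k))
      ≡⟨ cong (_+_ (Σcube m (λ w → coeff (s ∘ suc) w * δ (ι (lincomb (b ∘ suc) w)) k)))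
           (trans (*-distribˡ-Σcube m (s zero) _) (Σcube-cong m shifted)) ⟩
    Σcube (suc m) (λ w → coeff s w * δ (ι (lincomb b w)) k) ∎
    where
    open ≡-Reasoning
    y = ι (b zero)
    P = Πᴷ m (λ i → oneᴷ +ᴷ (s (suc i) • δ (ι (b (suc i)))))
    shifted : ∀ w → s zero * (coeff (s ∘ suc) w * δ (ι (lincomb (b ∘ suc) w)) (y ⁻¹ · k)) ≡
                    coeff s (true ∷ w) * δ (ι (lincomb b (true ∷ w))) k
    shifted w = trans (sym (ℤP.*-assoc (s zero) _ _))
      (cong (s zero * coeff (s ∘ suc) w *_)
            (trans (sym (δ-translate y (ι (lincomb (b ∘ suc) w)) k))
                   (cong (λ x → δ x k) (sym (ι-hom (b zero) (lincomb (b ∘ suc) w))))))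

  canonical : Vec Bool r → Fin n
  canonical w = ι (lincomb basis w)

  canonical-InE : ∀ w → InE (canonical w)
  canonical-InE w = lincomb basis w , refl

  canonical-injective : ∀ v w → canonical v ≡ canonical w → v ≡ w
  canonical-injective v w eq = lookup-injective v w λ i →
    trans (sym (lincomb-basis v i)) (trans (ι-inj _ _ eq i) (lincomb-basis w i))

  canonical-empty : canonical (replicate r false) ≡ e
  canonical-empty = trans (cong ι (lincomb-empty basis)) ι-zeroU

  χ-expansion : ∀ u k → χ u k ≡ Σcube r (λ w → coeff (sgn ∘ u) w * δ (canonical w) k)
  χ-expansion u = Πᴷ-expansion r basis (sgn ∘ u)

  χ-canonical : ∀ u w → χ u (canonical w) ≡ coeff (sgn ∘ u) w
  χ-canonical u w = begin
    χ u (canonical w)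
      ≡⟨ χ-expansion u (canonical w) ⟩
    Σcube r (λ v → coeff (sgn ∘ u) v * δ (canonical v) (canonical w))
      ≡⟨ Σcube-single r _ w (λ v v≢w → trans (cong (coeff (sgn ∘ u) v *_)
           (δ-off-diagonal (canonical v) (canonical w) (v≢w ∘ sym ∘ canonical-injective w v)))
           (ℤP.*-zeroʳ (coeff (sgn ∘ u) v))) ⟩
    coeff (sgn ∘ u) w * δ (canonical w) (canonical w)
      ≡⟨ cong (coeff (sgn ∘ u) w *_) (δ-diagonal (canonical w)) ⟩
    coeff (sgn ∘ u) w * + 1
      ≡⟨ ℤP.*-identityʳ _ ⟩
    coeff (sgn ∘ u) w ∎
    where open ≡-Reasoning

  χ-identity : ∀ u → χ u e ≡ + 1
  χ-identity u = begin
    χ u e                                ≡⟨ cong (χ u) canonical-empty ⟨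
    χ u (canonical (replicate r false))  ≡⟨ χ-canonical u (replicate r false) ⟩
    coeff (sgn ∘ u) (replicate r false)  ≡⟨ coeff-empty (sgn ∘ u) ⟩
    + 1                                  ∎
    where open ≡-Reasoning

  χ-support : ∀ u k → χ u k ≢ + 0 → ∃ λ w → canonical w ≡ k
  χ-support u k χk≢0 with Σcube-nonzero r _ (χk≢0 ∘ trans (χ-expansion u k))
  ... | w , term≢0 = w , decidable-stable (canonical w ≟F k) λ w≢k →
    term≢0 (trans (cong (coeff (sgn ∘ u) w *_) (δ-off-diagonal (canonical w) k (w≢k ∘ sym)))
                  (ℤP.*-zeroʳ (coeff (sgn ∘ u) w)))

  sgn-sign : ∀ b → IsSign (sgn b)
  sgn-sign false = inj₁ refl
  sgn-sign true  = inj₂ refl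

  χ-sign : ∀ u w → IsSign (χ u (canonical w))
  χ-sign u w = subst IsSign (sym (χ-canonical u w)) (coeff-sign (sgn ∘ u) (sgn-sign ∘ u) w)

  aug-χ : ∀ u → aug (χ u) ≡ Σcube r (coeff (sgn ∘ u))
  aug-χ u = begin
    Σℤ n (χ u)
      ≡⟨ Σℤ-cong n (χ-expansion u) ⟩
    Σℤ n (λ k → Σcube r (λ w → coeff (sgn ∘ u) w * δ (canonical w) k))
      ≡⟨ Σℤ-Σcube-comm r n _ ⟩
    Σcube r (λ w → Σℤ n (λ k → coeff (sgn ∘ u) w * δ (canonical w) k))
      ≡⟨ Σcube-cong r (λ w → trans (sym (*-distribˡ-Σℤ n (coeff (sgn ∘ u) w) (δ (canonical w))))
           (trans (cong (coeff (sgn ∘ u) w *_) (aug-δ (canonical w))) (ℤP.*-identityʳ (coeff (sgn ∘ u) w)))) ⟩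
    Σcube r (coeff (sgn ∘ u)) ∎
    where open ≡-Reasoning

  aug-χ-nonzero : ∀ u → (∃ λ i → u i ≡ true) → aug (χ u) ≡ + 0
  aug-χ-nonzero u (i , uᵢ≡1) = trans (aug-χ u) (Σcube-coeff-vanishes r (sgn ∘ u) i (cong sgn uᵢ≡1))

  aug-χ-zero : ∀ u → IsZeroU u → aug (χ u) ≡ + (2 ^ r)
  aug-χ-zero u u≡0 = trans (aug-χ u) (Σcube-coeff-ones r (sgn ∘ u) (cong sgn ∘ u≡0))

  χ-InE-support : ∀ u k → χ u k ≢ + 0 → InE k
  χ-InE-support u k χk≢0 with χ-support u k χk≢0
  ... | w , refl = canonical-InE w

  χ₀ : ℤK
  χ₀ = χ zeroU

  χ₀-canonical : ∀ w → χ₀ (canonical w) ≡ + 1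
  χ₀-canonical w = trans (χ-canonical zeroU w) (coeff-ones (sgn ∘ zeroU) (λ _ → refl) w)

  χ₀-indicator : ∀ k → χ₀ k ≡ + 0 ⊎ χ₀ k ≡ + 1
  χ₀-indicator k with χ₀ k ℤ.≟ + 0
  ... | yes χ₀k≡0 = inj₁ χ₀k≡0
  ... | no χ₀k≢0 with χ-support zeroU k χ₀k≢0
  ...   | w , refl = inj₂ (χ₀-canonical w)

  χ₀-translate-disjoint : ∀ z → (∀ i → z i ≡ false) → ∀ y → χ₀ y ≡ + 1 → χ₀ (y · ι z) ≡ + 1 → ι z ≡ e
  χ₀-translate-disjoint z z≡0 y χ₀y≡1 χ₀ya≡1
    with χ-support zeroU y (λ eq → case trans (sym χ₀y≡1) eq of λ ())
       | χ-support zeroU (y · ι z) (λ eq → case trans (sym χ₀ya≡1) eq of λ ())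
  ... | v , refl | w , w≡vz = ∙-cancelˡ (canonical v) (ι z) e (begin
    canonical v · ι z  ≡⟨ w≡vz ⟨
    canonical w        ≡⟨ cong canonical (sym v≡w) ⟩
    canonical v        ≡⟨ identityʳ (canonical v) ⟨
    canonical v · e    ∎)
    where
    open ≡-Reasoning
    v≡w : v ≡ w
    v≡w = lookup-injective v w λ i → begin
      lookup v i                             ≡⟨ lincomb-basis v i ⟨
      lincomb basis v i                      ≡⟨ xor-identityʳ (lincomb basis v i) ⟨
      lincomb basis v i xor false            ≡⟨ cong (lincomb basis v i xor_) (z≡0 i) ⟨
      (lincomb basis v ⊕ z) i                ≡⟨ ι-inj _ _ (trans (ι-hom (lincomb basis v) z) (sym w≡vz)) i ⟩
      lincomb basis w i                      ≡⟨ lincomb-basis w i ⟩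
      lookup w i                             ∎

  χ₀-translate-bound : ∀ z → (∀ i → z i ≡ false) → ι z ≢ e → ∀ y → χ₀ y + χ₀ (y · ι z) ≤ + 1
  χ₀-translate-bound z z≡0 a≢e y with χ₀-indicator y | χ₀-indicator (y · ι z)
  ... | inj₁ p | inj₁ q rewrite p | q = +≤+ z≤n
  ... | inj₁ p | inj₂ q rewrite p | q = +≤+ (s≤s z≤n)
  ... | inj₂ p | inj₁ q rewrite p | q = +≤+ (s≤s z≤n)
  ... | inj₂ p | inj₂ q = ⊥-elim (a≢e (χ₀-translate-disjoint z z≡0 y p q))

module SignatureBlock {n r : ℕ} (K : FinGroup n) (E : NormalElemAbSub K r)
                      (u : U r) (A : GroupRing.ℤK K) (block : Signature.IsSignatureBlock K E u A) where
  open import Data.Integer using (_+_; _*_; _≤_)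
  open Characters K E public

  T : Fin n → Bool
  T = proj₁ (proj₁ block)

  cover : ∀ g → ∃ λ t → T t ≡ true × InE (t ⁻¹ · g)
  cover = proj₁ (proj₁ (proj₂ (proj₁ block)))

  unique : ∀ t t' → T t ≡ true → T t' ≡ true → InE (t ⁻¹ · t') → t ≡ t'
  unique = proj₂ (proj₁ (proj₂ (proj₁ block)))

  A-sign : ∀ t → T t ≡ true → IsSign (A t)
  A-sign = proj₁ (proj₂ (proj₂ (proj₁ block)))

  A-off : ∀ g → T g ≡ false → A g ≡ + 0
  A-off = proj₂ (proj₂ (proj₂ (proj₁ block)))

  AχA⁻≡index•χ : ∀ g → (A *ᴷ χ u *ᴷ inv A) g ≡ ((+ index) • χ u) g
  AχA⁻≡index•χ = proj₂ block

  same-coset⇒same-rep : ∀ h k g → T h ≡ true → T k ≡ true → InE (h ⁻¹ · g) → InE (k ⁻¹ · g) → h ≡ k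
  same-coset⇒same-rep h k g Th Tk h⁻¹g∈E k⁻¹g∈E =
    unique h k Th Tk (subst InE h⁻¹g[k⁻¹g]⁻¹≡h⁻¹k (InE-· _ _ h⁻¹g∈E (InE-⁻¹ _ k⁻¹g∈E)))
    where
    open ≡-Reasoning
    h⁻¹g[k⁻¹g]⁻¹≡h⁻¹k : (h ⁻¹ · g) · (k ⁻¹ · g) ⁻¹ ≡ h ⁻¹ · k
    h⁻¹g[k⁻¹g]⁻¹≡h⁻¹k = begin
      (h ⁻¹ · g) · (k ⁻¹ · g) ⁻¹      ≡⟨ cong ((h ⁻¹ · g) ·_) (⁻¹-anti-homo-∙ (k ⁻¹) g) ⟩
      (h ⁻¹ · g) · (g ⁻¹ · k ⁻¹ ⁻¹)  ≡⟨ cong (λ x → (h ⁻¹ · g) · (g ⁻¹ · x)) (⁻¹-involutive k) ⟩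
      (h ⁻¹ · g) · (g ⁻¹ · k)        ≡⟨ assoc (h ⁻¹) g (g ⁻¹ · k) ⟩
      h ⁻¹ · (g · (g ⁻¹ · k))        ≡⟨ cong (h ⁻¹ ·_) (\\-leftDividesˡ g k) ⟩
      h ⁻¹ · k                       ∎

  *ᴷ-at-rep : ∀ (F G : ℤK) → (∀ h → F h ≢ + 0 → T h ≡ true) → (∀ k → G k ≢ + 0 → InE k) →
              ∀ g t → T t ≡ true → InE (t ⁻¹ · g) → (F *ᴷ G) g ≡ F t * G (t ⁻¹ · g)
  *ᴷ-at-rep F G F-on-T G-on-E g t Tt t⁻¹g∈E = Σℤ-single n _ t vanishes
    where
    vanishes : ∀ h → h ≢ t → F h * G (h ⁻¹ · g) ≡ + 0
    vanishes h h≢t with F h ℤ.≟ + 0 | G (h ⁻¹ · g) ℤ.≟ + 0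
    ... | yes Fh≡0 | _        = cong (_* G (h ⁻¹ · g)) Fh≡0
    ... | no _     | yes G≡0  = trans (cong (F h *_) G≡0) (ℤP.*-zeroʳ (F h))
    ... | no Fh≢0  | no G≢0   = ⊥-elim (h≢t (same-coset⇒same-rep h t g (F-on-T h Fh≢0) Tt (G-on-E _ G≢0) t⁻¹g∈E))

  A-on-T : ∀ h → A h ≢ + 0 → T h ≡ true
  A-on-T h Ah≢0 with T h in Th
  ... | true  = refl
  ... | false = ⊥-elim (Ah≢0 (A-off h Th))

  𝟙T : ℤK
  𝟙T k = if T k then + 1 else + 0

  𝟙T-on-T : ∀ h → 𝟙T h ≢ + 0 → T h ≡ true
  𝟙T-on-T h 𝟙Th≢0 with T h
  ... | true  = refl
  ... | false = ⊥-elim (𝟙Th≢0 refl)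

  𝟙T-nonneg : ∀ k → + 0 ≤ 𝟙T k
  𝟙T-nonneg k with T k
  ... | true  = +≤+ z≤n
  ... | false = +≤+ z≤n

  A*ᴷχ-on-T : ∀ k → T k ≡ true → (A *ᴷ χ u) k ≡ A k
  A*ᴷχ-on-T k Tk = begin
    (A *ᴷ χ u) k           ≡⟨ *ᴷ-at-rep A (χ u) A-on-T (χ-InE-support u) k k Tk k⁻¹k∈E ⟩
    A k * χ u (k ⁻¹ · k)   ≡⟨ cong (λ x → A k * χ u x) (inverseˡ k) ⟩
    A k * χ u e            ≡⟨ cong (A k *_) (χ-identity u) ⟩
    A k * + 1              ≡⟨ ℤP.*-identityʳ (A k) ⟩
    A k                    ∎
    where
    open ≡-Reasoning
    k⁻¹k∈E : InE (k ⁻¹ · k)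
    k⁻¹k∈E = zeroU , trans (inverseˡ k) (sym ι-zeroU)

  A*ᴷχ·A≡𝟙T : ∀ k → (A *ᴷ χ u) k * A k ≡ 𝟙T k
  A*ᴷχ·A≡𝟙T k with T k in Tk
  ... | false = trans (cong ((A *ᴷ χ u) k *_) (A-off k Tk)) (ℤP.*-zeroʳ ((A *ᴷ χ u) k))
  ... | true  = trans (cong (_* A k) (A*ᴷχ-on-T k Tk)) (IsSign-square (A-sign k Tk))

  -- Evaluate A χ_u A^(-1) = index · χ_u at the identity.
  |T|≡index : aug 𝟙T ≡ + index
  |T|≡index = begin
    Σℤ n 𝟙T                                  ≡⟨ Σℤ-cong n A*ᴷχ·A≡𝟙T ⟨
    Σℤ n (λ k → (A *ᴷ χ u) k * A k)          ≡⟨ Σℤ-cong n (λ k → cong (λ x → (A *ᴷ χ u) k * A x) [k⁻¹e]⁻¹≡k) ⟨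
    (A *ᴷ χ u *ᴷ inv A) e                    ≡⟨ AχA⁻≡index•χ e ⟩
    + index * χ u e                          ≡⟨ cong (+ index *_) (χ-identity u) ⟩
    + index * + 1                            ≡⟨ ℤP.*-identityʳ (+ index) ⟩
    + index                                  ∎
    where
    open ≡-Reasoning
    [k⁻¹e]⁻¹≡k : ∀ {k} → (k ⁻¹ · e) ⁻¹ ≡ k
    [k⁻¹e]⁻¹≡k {k} = trans (cong _⁻¹ (identityʳ (k ⁻¹))) (⁻¹-involutive k)

  index≥1 : 1 ℕ.≤ index
  index≥1 with cover e
  ... | t , Tt , _ = ℤP.drop‿+≤+ (begin
    + 1       ≡⟨ cong (λ b → if b then + 1 else + 0) Tt ⟨
    𝟙T t      ≤⟨ Σℤ-term-≤ n 𝟙T 𝟙T-nonneg t ⟩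
    aug 𝟙T    ≡⟨ |T|≡index ⟩
    + index   ∎)
    where open ℤP.≤-Reasoning

  coverCount : ℤK
  coverCount = 𝟙T *ᴷ χ₀

  coverCount-at : ∀ g t → T t ≡ true → InE (t ⁻¹ · g) → coverCount g ≡ χ₀ (t ⁻¹ · g)
  coverCount-at g t Tt t⁻¹g∈E = begin
    coverCount g                        ≡⟨ *ᴷ-at-rep 𝟙T χ₀ 𝟙T-on-T (χ-InE-support zeroU) g t Tt t⁻¹g∈E ⟩
    𝟙T t * χ₀ (t ⁻¹ · g)       ≡⟨ cong (λ b → (if b then + 1 else + 0) * χ₀ (t ⁻¹ · g)) Tt ⟩
    + 1 * χ₀ (t ⁻¹ · g)        ≡⟨ ℤP.*-identityˡ (χ₀ (t ⁻¹ · g)) ⟩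
    χ₀ (t ⁻¹ · g)              ∎
    where open ≡-Reasoning

  aug-coverCount : aug coverCount ≡ + (index ℕ.* 2 ^ r)
  aug-coverCount = begin
    aug coverCount         ≡⟨ aug-homo-*ᴷ 𝟙T χ₀ ⟩
    aug 𝟙T * aug χ₀        ≡⟨ cong₂ _*_ |T|≡index (aug-χ-zero zeroU (λ _ → refl)) ⟩
    + index * + (2 ^ r)    ≡⟨ ℤP.pos-* index (2 ^ r) ⟨
    + (index ℕ.* 2 ^ r)    ∎
    where open ≡-Reasoning

  coverCount-translate-bound : ∀ z → (∀ i → z i ≡ false) → ι z ≢ e →
                               ∀ g → coverCount g + coverCount (g · ι z) ≤ + 1
  coverCount-translate-bound z z≡0 ιz≢e g with cover g
  ... | t , Tt , t⁻¹g∈E = subst (_≤ + 1) (sym (cong₂ _+_ (coverCount-at g t Tt t⁻¹g∈E) at-translate))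
                                (χ₀-translate-bound z z≡0 ιz≢e (t ⁻¹ · g))
    where
    at-translate : coverCount (g · ι z) ≡ χ₀ (t ⁻¹ · g · ι z)
    at-translate = trans (coverCount-at (g · ι z) t Tt t⁻¹gιz∈E) (cong χ₀ (sym (assoc (t ⁻¹) g (ι z))))
      where
      t⁻¹gιz∈E : InE (t ⁻¹ · (g · ι z))
      t⁻¹gιz∈E = subst InE (assoc (t ⁻¹) g (ι z)) (InE-· _ _ t⁻¹g∈E (z , refl))

  twice-aug-coverCount≤n : ∀ z → (∀ i → z i ≡ false) → ι z ≢ e → aug coverCount + aug coverCount ≤ + n
  twice-aug-coverCount≤n z z≡0 ιz≢e = begin
    aug coverCount + aug coverCount
      ≡⟨ cong (_+_ (aug coverCount)) (aug-translateʳ coverCount (ι z)) ⟨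
    aug coverCount + Σℤ n (λ g → coverCount (g · ι z))
      ≡⟨ Σℤ-distrib-+ n coverCount (λ g → coverCount (g · ι z)) ⟨
    Σℤ n (λ g → coverCount g + coverCount (g · ι z))
      ≤⟨ Σℤ-mono-≤ n (coverCount-translate-bound z z≡0 ιz≢e) ⟩
    Σℤ n (λ _ → + 1)
      ≡⟨ Σℤ-ones n ⟩
    + n ∎
    where open ℤP.≤-Reasoning

  -- ι is not known to respect pointwise equality of vectors (there is no function extensionality),
  -- so a priori E could be larger than its 2^r canonical elements; the index condition |T| = |K|/2^r
  -- rules this out.
  ι-pointwise-zero : ∀ z → (∀ i → z i ≡ false) → ι z ≡ e
  ι-pointwise-zero z z≡0 = decidable-stable (ι z ≟F e) λ ιz≢e →
    [m/n*n]+[m/n*n]≰m n (2 ^ r) {{ℕP.m^n≢0 2 r}} index≥1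
      (ℤP.drop‿+≤+ (subst (_≤ + n) twice-aug≡ (twice-aug-coverCount≤n z z≡0 ιz≢e)))
    where
    twice-aug≡ : aug coverCount + aug coverCount ≡ + (index ℕ.* 2 ^ r ℕ.+ index ℕ.* 2 ^ r)
    twice-aug≡ = trans (cong₂ _+_ aug-coverCount aug-coverCount) (sym (ℤP.pos-+ (index ℕ.* 2 ^ r) (index ℕ.* 2 ^ r)))

  ι-cong : ∀ v w → (∀ i → v i ≡ w i) → ι v ≡ ι w
  ι-cong v w v≗w = ∙-cancelʳ (ι w) (ι v) (ι w) (begin
    ι v · ι w   ≡⟨ ι-hom v w ⟨
    ι (v ⊕ w)   ≡⟨ ι-pointwise-zero (v ⊕ w) (λ i → trans (cong (_xor w i) (v≗w i)) (xor-same (w i))) ⟩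
    e           ≡⟨ ι-pointwise-zero (w ⊕ w) (λ i → xor-same (w i)) ⟨
    ι (w ⊕ w)   ≡⟨ ι-hom w w ⟩
    ι w · ι w   ∎)
    where open ≡-Reasoning

  InE⇒canonical : ∀ k → InE k → ∃ λ w → canonical w ≡ k
  InE⇒canonical _ (v , refl) =
    tabulate v , ι-cong _ v (λ i → trans (lincomb-basis (tabulate v) i) (lookup∘tabulate v i))

  coverCount-one : ∀ g → coverCount g ≡ + 1
  coverCount-one g with cover g
  ... | t , Tt , t⁻¹g∈E with InE⇒canonical _ t⁻¹g∈E
  ...   | w , w≡t⁻¹g = trans (coverCount-at g t Tt t⁻¹g∈E) (trans (cong χ₀ (sym w≡t⁻¹g)) (χ₀-canonical w))

  n≡index*2^r : n ≡ index ℕ.* 2 ^ r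
  n≡index*2^r = ℤP.+-injective (begin
    + n                    ≡⟨ Σℤ-ones n ⟨
    Σℤ n (λ _ → + 1)       ≡⟨ Σℤ-cong n coverCount-one ⟨
    aug coverCount         ≡⟨ aug-coverCount ⟩
    + (index ℕ.* 2 ^ r)    ∎)
    where open ≡-Reasoning

  B : ℤK
  B = A *ᴷ χ u

  B-sign : ∀ g → IsSign (B g)
  B-sign g with cover g
  ... | t , Tt , t⁻¹g∈E with InE⇒canonical _ t⁻¹g∈E
  ...   | w , w≡t⁻¹g = subst IsSign (sym B-at) (IsSign-* (A-sign t Tt) (χ-sign u w))
    where
    B-at : B g ≡ A t * χ u (canonical w)
    B-at = trans (*ᴷ-at-rep A (χ u) A-on-T (χ-InE-support u) g t Tt t⁻¹g∈E) (cong (λ x → A t * χ u x) (sym w≡t⁻¹g))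

  -- countMinusOne is the count over allFin n = tabulate id.
  aug-B+2*count≡n : aug B + + (2 ℕ.* countMinusOne B) ≡ + n
  aug-B+2*count≡n = trans (cong (_+_ (aug B)) (ℤP.pos-* 2 (countMinusOne B))) (Σℤ±1+2*count B n id B-sign)

  aug-B≡0 : (∃ λ i → u i ≡ true) → aug B ≡ + 0
  aug-B≡0 u≢0 = begin
    aug B                 ≡⟨ aug-homo-*ᴷ A (χ u) ⟩
    aug A * aug (χ u)     ≡⟨ cong (aug A *_) (aug-χ-nonzero u u≢0) ⟩
    aug A * + 0           ≡⟨ ℤP.*-zeroʳ (aug A) ⟩
    + 0                   ∎
    where open ≡-Reasoning

  aug-B≡aug-A*2^r : IsZeroU u → aug B ≡ aug A * + (2 ^ r)
  aug-B≡aug-A*2^r u≡0 = trans (aug-homo-*ᴷ A (χ u)) (cong (aug A *_) (aug-χ-zero u u≡0))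

  aug-A*2^r*aug-A≡index*2^r : IsZeroU u → aug A * + (2 ^ r) * aug A ≡ + index * + (2 ^ r)
  aug-A*2^r*aug-A≡index*2^r u≡0 = begin
    aug A * + (2 ^ r) * aug A          ≡⟨ cong (_* aug A) (aug-B≡aug-A*2^r u≡0) ⟨
    aug B * aug A                      ≡⟨ cong (aug B *_) (aug-inv A) ⟨
    aug B * aug (inv A)                ≡⟨ aug-homo-*ᴷ B (inv A) ⟨
    aug (A *ᴷ χ u *ᴷ inv A)            ≡⟨ Σℤ-cong n AχA⁻≡index•χ ⟩
    Σℤ n (λ g → + index * χ u g)       ≡⟨ *-distribˡ-Σℤ n (+ index) (χ u) ⟨
    + index * aug (χ u)                ≡⟨ cong (+ index *_) (aug-χ-zero u u≡0) ⟩
    + index * + (2 ^ r)                ∎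
    where open ≡-Reasoning

  ∣aug-A∣²≡index : IsZeroU u → ∣ aug A ∣ ℕ.* ∣ aug A ∣ ≡ index
  ∣aug-A∣²≡index u≡0 = begin
    ∣ aug A ∣ ℕ.* ∣ aug A ∣   ≡⟨ ℤP.abs-* (aug A) (aug A) ⟨
    ∣ aug A * aug A ∣         ≡⟨ cong ∣_∣ aug-A²≡index ⟩
    index                     ∎
    where
    open ≡-Reasoning
    rearranged : aug A * aug A * + (2 ^ r) ≡ + index * + (2 ^ r)
    rearranged = trans (ℤP.*-assoc (aug A) (aug A) (+ (2 ^ r)))
      (trans (cong (aug A *_) (ℤP.*-comm (aug A) (+ (2 ^ r))))
        (trans (sym (ℤP.*-assoc (aug A) (+ (2 ^ r)) (aug A))) (aug-A*2^r*aug-A≡index*2^r u≡0)))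
    aug-A²≡index : aug A * aug A ≡ + index
    aug-A²≡index = ℤP.*-cancelʳ-≡ (aug A * aug A) (+ index) (+ (2 ^ r)) {{ℕP.m^n≢0 2 r}} rearranged

open import Data.Nat using (_+_; _*_)

+-split-by-sign : ∀ x m k → x ℤ.+ + m ≡ + k → m ≡ k + ∣ x ∣ ⊎ m + ∣ x ∣ ≡ k
+-split-by-sign (+ a)     m k eq = inj₂ (trans (ℕP.+-comm m a) (ℤP.+-injective eq))
+-split-by-sign -[1+ a ]  m k eq = inj₁ (ℤP.+-injective (begin
  + m                              ≡⟨ cancel -[1+ a ] (+ m) ⟩
  + suc a ℤ.+ (-[1+ a ] ℤ.+ + m)   ≡⟨ cong (ℤ._+_ (+ suc a)) eq ⟩
  + suc a ℤ.+ + k                  ≡⟨ ℤP.+-comm (+ suc a) (+ k) ⟩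
  + (k + suc a)                    ∎))
  where
  open ≡-Reasoning
  open +-*-Solver
  cancel : ∀ x y → y ≡ - x ℤ.+ (x ℤ.+ y)
  cancel = solve 2 (λ x y → y := :- x :+ (x :+ y)) refl

square-scaling : ∀ a P q n → a * a ≡ q → n ≡ q * P → (a * P) * (a * P) ≡ P * n
square-scaling a P q n refl refl = solve 2 (λ a P → (a :* P) :* (a :* P) := P :* (a :* a :* P)) refl a P
  where open ℕSolver.+-*-Solver

lemma2p6 : ∀ {n r : ℕ} (K : FinGroup n) (E : NormalElemAbSub K r)
             (A : U r → GroupRing.ℤK K) →
             Signature.IsSignatureSet K E A →
             ∀ (u : U r) →
             let N = Signature.countMinusOne K E (GroupRing._*ᴷ_ K (A u) (Signature.χ K E u)) in
             ((∃ λ (i : Fin r) → u i ≡ true) → 2 * N ≡ n) ×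
             (IsZeroU u → Σ ℕ λ s → (s * s ≡ 2 ^ r * n) × (2 * N ≡ n + s ⊎ 2 * N + s ≡ n))
lemma2p6 {n} {r} K E A signatureSet u = nonzero-case , zero-case
  where
  open SignatureBlock K E u (A u) (signatureSet u)
  N = countMinusOne B

  nonzero-case : (∃ λ i → u i ≡ true) → 2 * N ≡ n
  nonzero-case u≢0 = ℤP.+-injective (begin
    + (2 * N)              ≡⟨ ℤP.+-identityˡ (+ (2 * N)) ⟨
    + 0 ℤ.+ + (2 * N)      ≡⟨ cong (ℤ._+ + (2 * N)) (aug-B≡0 u≢0) ⟨
    aug B ℤ.+ + (2 * N)    ≡⟨ aug-B+2*count≡n ⟩
    + n                    ∎)
    where open ≡-Reasoning

  zero-case : IsZeroU u → Σ ℕ λ s → (s * s ≡ 2 ^ r * n) × (2 * N ≡ n + s ⊎ 2 * N + s ≡ n)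
  zero-case u≡0 = ∣ aug (A u) ∣ * 2 ^ r
                , square-scaling ∣ aug (A u) ∣ (2 ^ r) index n (∣aug-A∣²≡index u≡0) n≡index*2^r
                , subst (λ s → 2 * N ≡ n + s ⊎ 2 * N + s ≡ n) (ℤP.abs-* (aug (A u)) (+ (2 ^ r)))
                    (+-split-by-sign (aug (A u) ℤ.* + (2 ^ r)) (2 * N) n
                      (trans (cong (ℤ._+ + (2 * N)) (sym (aug-B≡aug-A*2^r u≡0))) aug-B+2*count≡n))
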